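{- For $k\ge 0$ let $b^+_k$ denote the number of elements of length $k$ in $\mathcal{MB}^+_3$. Then $$\sum_{k\ge 0} b^+_k t^k = 1+2t+4t^2+6t^3+10t^4+16t^5+\cdots,$$ where $b^+_k=2F_{k+1}$ for all $k\ge 1$.
   Context: $(F_n)_{n\ge 0}$ is the Fibonacci sequence $F_0=0$, $F_1=1$, $F_{n+1}=F_n+F_{n-1}$. The monoid of positive $n$-braids $\mathcal{MB}_n$ is the monoid with generators $x_1,\dots,x_{n-1}$ and relations $x_ix_j=x_jx_i$ for $|i-j|\ge 2$ and $x_ix_{i+1}x_i=x_{i+1}x_ix_{i+1}$ for $1\le i\le n-2$; word length is well defined on it. The Garside braid is $\Delta_n=x_1(x_2x_1)\cdots(x_{n-1}x_{n-2}\cdots x_1)$ (so $\Delta_3=x_1x_2x_1$). $\mathcal{MB}^+_n$ is the set of positive $n$-braids that do not contain $\Delta_n$ as a subword, i.e. positive braids $\beta$ which cannot be written as $\beta=\alpha\Delta_n\gamma$ with $\alpha,\gamma\in\mathcal{MB}_n$. -}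

module Defs where

open import Data.Nat using (ℕ; zero; suc; _+_; _*_; _≤_)
open import Data.List using (List; []; _∷_; _++_; length)
open import Data.List.Relation.Unary.All using (All)
open import Data.List.Relation.Unary.Any using (Any)
open import Data.List.Relation.Unary.AllPairs using (AllPairs)
open import Data.Product using (_×_; ∃; ∃-syntax)
open import Relation.Nullary using (¬_)
open import Relation.Binary.PropositionalEquality using (_≡_)
open import Relation.Binary.Construct.Closure.Equivalence using (EqClosure)

fib : ℕ → ℕ
fib zero = 0
fib (suc zero) = 1
fib (suc (suc n)) = fib (suc n) + fib n

-- Generators of the positive 3-braid monoid MB_3
data Gen : Set where
  x₁ x₂ : Gen

Word : Set
Word = List Gen

-- One-step application of the braid relation x₁x₂x₁ = x₂x₁x₂ inside a word
-- (for n = 3 there are no commutation relations |i-j| ≥ 2)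
data BraidStep : Word → Word → Set where
  braid : (u v : Word) → BraidStep (u ++ x₁ ∷ x₂ ∷ x₁ ∷ v) (u ++ x₂ ∷ x₁ ∷ x₂ ∷ v)

-- Equality in MB_3: the congruence generated by the relation
-- (equivalence closure of the one-step rewrite)
_≈B_ : Word → Word → Set
_≈B_ = EqClosure BraidStep

Δ₃ : Word
Δ₃ = x₁ ∷ x₂ ∷ x₁ ∷ []

ContainsΔ : Word → Set
ContainsΔ β = ∃[ α ] ∃[ γ ] (β ≈B (α ++ Δ₃ ++ γ))

InMB⁺Len : ℕ → Word → Set
InMB⁺Len k w = (length w ≡ k) × (¬ ContainsΔ w)

-- "MB⁺_3 has exactly N elements of length k":
-- there is a list of N words representing pairwise distinct elements of
-- MB⁺_3 of length k, and every element of MB⁺_3 of length k is among them.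
NumElemsOfLength : ℕ → ℕ → Set
NumElemsOfLength k N =
  ∃[ ws ] ( (length ws ≡ N)
          × All (InMB⁺Len k) ws
          × AllPairs (λ u v → ¬ (u ≈B v)) ws
          × (∀ w → InMB⁺Len k w → Any (λ u → w ≈B u) ws) )

-- Call a factor  x₁x₂x₁  or  x₂x₁x₂  of a word a *braid factor*, and a word
-- without one *braid-free*.  Every rewrite step of the braid relation acts
-- on a braid factor, so a braid-free word is equivalent only to itself.
-- Hence a word contains Δ₃ exactly when it has a braid factor: a factor
-- x₁x₂x₁ is Δ₃ itself and a factor x₂x₁x₂ becomes Δ₃ after one step, while a
-- braid-free word equals its only representative, which has no factor Δ₃.
-- The braid-free words are therefore normal forms for MB⁺₃, and counting
-- MB⁺₃ by length amounts to counting braid-free words.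
--
-- A braid-free word beginning with a continues either with a, or with the
-- other letter b twice (a b a is forbidden).  This gives an explicit list
-- `free a n` of the braid-free words of length n+1 starting with a, of
-- Fibonacci length F(n+2); the two first letters give 2F(k+1) words of
-- length k ≥ 1, and the empty word is the only one of length 0.

module Submission where

open import Defs
open import Data.Nat using (ℕ; zero; suc; _+_; _*_; _≤_; s≤s; z≤n)
open import Data.Nat.Properties using (+-identityʳ)
open import Data.List using (List; []; _∷_; _++_; length; map)
open import Data.List.Properties using (length-++; length-map; ∷-injectiveˡ; ∷-injectiveʳ)
open import Data.List.Relation.Unary.All as All using (All; []; _∷_)
open import Data.List.Relation.Unary.Any as Any using (here; there)
open import Data.List.Relation.Unary.AllPairs using (AllPairs; []; _∷_)
open import Data.List.Membership.Propositional using (_∈_)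
open import Data.List.Membership.Propositional.Properties using (∈-map⁺; ∈-map⁻; ∈-++⁺ˡ; ∈-++⁺ʳ; ∈-++⁻)
open import Data.List.Relation.Unary.Unique.Propositional using (Unique)
import Data.List.Relation.Unary.Unique.Propositional.Properties as Unique
open import Data.Product using (_×_; _,_)
open import Data.Sum using (inj₁; inj₂; [_,_]′)
open import Data.Empty using (⊥-elim)
open import Function using (_∘_)
open import Relation.Nullary using (¬_)
open import Relation.Binary.PropositionalEquality using (_≡_; _≢_; refl; sym; cong; cong₂; subst; module ≡-Reasoning)
open import Relation.Binary.Construct.Closure.ReflexiveTransitive using (ε; _◅_)
open import Relation.Binary.Construct.Closure.Symmetric using (fwd; bwd)
import Relation.Binary.Construct.Closure.Equivalence as EqClosure

allPairs-mapWith : {A : Set} {P : A → Set} {R S : A → A → Set} →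
                   (∀ {x y} → P x → R x y → S x y) →
                   ∀ {xs} → All P xs → AllPairs R xs → AllPairs S xs
allPairs-mapWith f []         []         = []
allPairs-mapWith f (px ∷ pxs) (rx ∷ rxs) = All.map (f px) rx ∷ allPairs-mapWith f pxs rxs

data BraidFactor : Word → Set where
  here₁₂₁ : ∀ r → BraidFactor (x₁ ∷ x₂ ∷ x₁ ∷ r)
  here₂₁₂ : ∀ r → BraidFactor (x₂ ∷ x₁ ∷ x₂ ∷ r)
  there   : ∀ a {w} → BraidFactor w → BraidFactor (a ∷ w)

BraidFree : Word → Set
BraidFree w = ¬ BraidFactor w

factor-++ : ∀ u {w} → BraidFactor w → BraidFactor (u ++ w)
factor-++ []      φ = φ
factor-++ (a ∷ u) φ = there a (factor-++ u φ)

-- Both sides of a braid rewrite step contain a braid factor, so a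
-- braid-free word admits no step and is equivalent only to itself.
free-rigid : ∀ {w w′} → BraidFree w → w ≈B w′ → w ≡ w′
free-rigid f ε                     = refl
free-rigid f (fwd (braid u v) ◅ _) = ⊥-elim (f (factor-++ u (here₁₂₁ v)))
free-rigid f (bwd (braid u v) ◅ _) = ⊥-elim (f (factor-++ u (here₂₁₂ v)))

-- A braid-free word equals its only representative, which lacks x₁x₂x₁.
free⇒¬ContainsΔ : ∀ {w} → BraidFree w → ¬ ContainsΔ w
free⇒¬ContainsΔ f (α , γ , w≈αΔγ) =
  f (subst BraidFactor (sym (free-rigid f w≈αΔγ)) (factor-++ α (here₁₂₁ γ)))

ContainsΔ-∷ : ∀ a {w} → ContainsΔ w → ContainsΔ (a ∷ w)
ContainsΔ-∷ a (α , γ , w≈αΔγ) = a ∷ α , γ , EqClosure.gmap (a ∷_) prefix w≈αΔγ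
  where
  prefix : ∀ {u v} → BraidStep u v → BraidStep (a ∷ u) (a ∷ v)
  prefix (braid u v) = braid (a ∷ u) v

-- A factor x₁x₂x₁ is Δ₃; a factor x₂x₁x₂ turns into Δ₃ by one braid step.
factor⇒ContainsΔ : ∀ {w} → BraidFactor w → ContainsΔ w
factor⇒ContainsΔ (here₁₂₁ r)  = [] , r , ε
factor⇒ContainsΔ (here₂₁₂ r)  = [] , r , bwd (braid [] r) ◅ ε
factor⇒ContainsΔ (there a φ)  = ContainsΔ-∷ a (factor⇒ContainsΔ φ)

¬ContainsΔ⇒free : ∀ {w} → ¬ ContainsΔ w → BraidFree w
¬ContainsΔ⇒free noΔ = noΔ ∘ factor⇒ContainsΔ

other : Gen → Gen
other x₁ = x₂
other x₂ = x₁

other-≢ : ∀ a → a ≢ other a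
other-≢ x₁ ()
other-≢ x₂ ()

data Compare (a : Gen) : Gen → Set where
  same : Compare a a
  diff : Compare a (other a)

compare : ∀ a b → Compare a b
compare x₁ x₁ = same
compare x₁ x₂ = diff
compare x₂ x₁ = diff
compare x₂ x₂ = same

alternating-factor : ∀ a r → BraidFactor (a ∷ other a ∷ other (other a) ∷ r)
alternating-factor x₁ r = here₁₂₁ r
alternating-factor x₂ r = here₂₁₂ r

free-tail : ∀ {a w} → BraidFree (a ∷ w) → BraidFree w
free-tail f = f ∘ there _

free-short : ∀ a b → BraidFree (a ∷ b ∷ [])
free-short a b (there _ (there _ ()))

free-doubled : ∀ a r → BraidFree (a ∷ r) → BraidFree (a ∷ a ∷ r)
free-doubled a r f (there _ φ) = f φ

free-switched : ∀ a r → BraidFree (other a ∷ r) → BraidFree (a ∷ other a ∷ other a ∷ r)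
free-switched x₁ r f (there _ φ) = free-doubled x₂ r f φ
free-switched x₂ r f (there _ φ) = free-doubled x₁ r f φ

data FreeWord (a : Gen) (n : ℕ) : Word → Set where
  freeWord : ∀ r → length r ≡ n → BraidFree (a ∷ r) → FreeWord a n (a ∷ r)

-- `free a n` lists the braid-free words of length n+1 starting with a:
-- such a word continues either with a, or (for n ≥ 2) with b b for b ≠ a.
free : Gen → ℕ → List Word
free a zero          = (a ∷ []) ∷ []
free a (suc zero)    = (a ∷ a ∷ []) ∷ (a ∷ other a ∷ []) ∷ []
free a (suc (suc n)) = map (a ∷_) (free a (suc n))
                    ++ map (λ w → a ∷ other a ∷ w) (free (other a) n)

free-sound : ∀ a n {w} → w ∈ free a n → FreeWord a n w
free-sound a zero          (here refl)         = freeWord [] refl (free-tail (free-short a a))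
free-sound a (suc zero)    (here refl)         = freeWord _ refl (free-short a a)
free-sound a (suc zero)    (there (here refl)) = freeWord _ refl (free-short a (other a))
free-sound a (suc (suc n)) w∈ with ∈-++⁻ (map (a ∷_) (free a (suc n))) w∈
... | inj₁ w∈₁ with ∈-map⁻ (a ∷_) w∈₁
...   | v , v∈ , refl with free-sound a (suc n) v∈
...     | freeWord r len f = freeWord (a ∷ r) (cong suc len) (free-doubled a r f)
free-sound a (suc (suc n)) w∈ | inj₂ w∈₂ with ∈-map⁻ (λ w → a ∷ other a ∷ w) w∈₂
...   | v , v∈ , refl with free-sound (other a) n v∈
...     | freeWord r len f = freeWord (other a ∷ other a ∷ r) (cong (suc ∘ suc) len) (free-switched a r f)

-- A braid-free word a b c … arises from b c … (when b = a) or from c …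
-- (when b ≠ a, which forces c = b); both recursive results are supplied.
free-complete : ∀ a r → BraidFree (a ∷ r) → a ∷ r ∈ free a (length r)
free-complete a [] _ = here refl
free-complete a (b ∷ []) _ with compare a b
... | same = here refl
... | diff = there (here refl)
free-complete a (b ∷ c ∷ r) f =
  extend (compare a b) (compare b c) f
    (free-complete b (c ∷ r) (free-tail f)) (free-complete c r (free-tail (free-tail f)))
  where
  extend : ∀ {b c} → Compare a b → Compare b c → BraidFree (a ∷ b ∷ c ∷ r) →
           b ∷ c ∷ r ∈ free b (suc (length r)) → c ∷ r ∈ free c (length r) →
           a ∷ b ∷ c ∷ r ∈ free a (suc (suc (length r)))
  extend same _    _ bcr∈ _   = ∈-++⁺ˡ (∈-map⁺ (a ∷_) bcr∈)
  extend diff same _ _    cr∈ = ∈-++⁺ʳ (map (a ∷_) (free a (suc (length r))))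
                                        (∈-map⁺ (λ w → a ∷ other a ∷ w) cr∈)
  extend diff diff f _    _   = ⊥-elim (f (alternating-factor a r))

free-length : ∀ a n → length (free a n) ≡ fib (suc (suc n))
free-length a zero          = refl
free-length a (suc zero)    = refl
free-length a (suc (suc n)) = begin
  length (map (a ∷_) (free a (suc n)) ++ map (λ w → a ∷ other a ∷ w) (free (other a) n))
    ≡⟨ length-++ (map (a ∷_) (free a (suc n))) ⟩
  length (map (a ∷_) (free a (suc n))) + length (map (λ w → a ∷ other a ∷ w) (free (other a) n))
    ≡⟨ cong₂ _+_ (length-map (a ∷_) (free a (suc n))) (length-map (λ w → a ∷ other a ∷ w) (free (other a) n)) ⟩
  length (free a (suc n)) + length (free (other a) n)
    ≡⟨ cong₂ _+_ (free-length a (suc n)) (free-length (other a) n) ⟩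
  fib (suc (suc (suc n))) + fib (suc (suc n))
    ∎
  where open ≡-Reasoning

free-unique : ∀ a n → Unique (free a n)
free-unique a zero          = [] ∷ []
free-unique a (suc zero)    = (other-≢ a ∘ ∷-injectiveˡ ∘ ∷-injectiveʳ ∷ []) ∷ [] ∷ []
free-unique a (suc (suc n)) =
  Unique.++⁺ (Unique.map⁺ ∷-injectiveʳ (free-unique a (suc n)))
             (Unique.map⁺ (∷-injectiveʳ ∘ ∷-injectiveʳ) (free-unique (other a) n))
             disjoint
  where
  -- words of the first part continue with a, those of the second with other a
  disjoint : ∀ {w} → ¬ (w ∈ map (a ∷_) (free a (suc n))
                       × w ∈ map (λ v → a ∷ other a ∷ v) (free (other a) n))
  disjoint (w∈₁ , w∈₂) with ∈-map⁻ (a ∷_) w∈₁ | ∈-map⁻ (λ v → a ∷ other a ∷ v) w∈₂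
  ... | v , v∈ , refl | _ , _ , eq with free-sound a (suc n) v∈
  ... | freeWord _ _ _ = other-≢ a (∷-injectiveˡ (∷-injectiveʳ eq))

count-normal-forms : ∀ k (ws : List Word) → Unique ws →
                     All (λ w → length w ≡ k × BraidFree w) ws →
                     (∀ w → length w ≡ k → BraidFree w → w ∈ ws) →
                     NumElemsOfLength k (length ws)
count-normal-forms k ws unique sound complete =
    ws , refl
  , All.map (λ (len , f) → len , free⇒¬ContainsΔ f) sound
  , allPairs-mapWith (λ (_ , f) u≢v u≈v → u≢v (free-rigid f u≈v)) sound unique
  , λ w (len , noΔ) → Any.map (λ { refl → ε }) (complete w len (¬ContainsΔ⇒free noΔ))

words : ℕ → List Word
words n = free x₁ n ++ free x₂ n

words-sound : ∀ n → All (λ w → length w ≡ suc n × BraidFree w) (words n)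
words-sound n = All.tabulate λ w∈ →
  [ freeWord-props ∘ free-sound x₁ n , freeWord-props ∘ free-sound x₂ n ]′ (∈-++⁻ (free x₁ n) w∈)
  where
  freeWord-props : ∀ {a w} → FreeWord a n w → length w ≡ suc n × BraidFree w
  freeWord-props (freeWord _ len f) = cong suc len , f

words-complete : ∀ n w → length w ≡ suc n → BraidFree w → w ∈ words n
words-complete _ (x₁ ∷ r) refl f = ∈-++⁺ˡ (free-complete x₁ r f)
words-complete _ (x₂ ∷ r) refl f = ∈-++⁺ʳ (free x₁ (length r)) (free-complete x₂ r f)

words-unique : ∀ n → Unique (words n)
words-unique n = Unique.++⁺ (free-unique x₁ n) (free-unique x₂ n) disjoint
  where
  disjoint : ∀ {w} → ¬ (w ∈ free x₁ n × w ∈ free x₂ n)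
  disjoint (w∈₁ , w∈₂) with free-sound x₁ n w∈₁ | free-sound x₂ n w∈₂
  ... | freeWord _ _ _ | ()

words-length : ∀ n → length (words n) ≡ 2 * fib (suc (suc n))
words-length n = begin
  length (free x₁ n ++ free x₂ n)            ≡⟨ length-++ (free x₁ n) ⟩
  length (free x₁ n) + length (free x₂ n)    ≡⟨ cong₂ _+_ (free-length x₁ n) (free-length x₂ n) ⟩
  fib (suc (suc n)) + fib (suc (suc n))      ≡⟨ cong (fib (suc (suc n)) +_) (sym (+-identityʳ _)) ⟩
  2 * fib (suc (suc n))                      ∎
  where open ≡-Reasoning

theorem1p3 : NumElemsOfLength 0 1
    × ((k : ℕ) → 1 ≤ k → NumElemsOfLength k (2 * fib (suc k)))
theorem1p3 = count-empty , count-positive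
  where
  count-empty : NumElemsOfLength 0 1
  count-empty = count-normal-forms 0 ([] ∷ []) ([] ∷ [])
    ((refl , λ ()) ∷ []) (λ { [] _ _ → here refl })

  count-positive : (k : ℕ) → 1 ≤ k → NumElemsOfLength k (2 * fib (suc k))
  count-positive (suc n) (s≤s z≤n) =
    subst (NumElemsOfLength (suc n)) (words-length n)
      (count-normal-forms (suc n) (words n) (words-unique n) (words-sound n) (words-complete n))
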